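{- Let $k\ge 3$ and let $\mathcal{H}$ be a simple connected $k$-uniform hypergraph. Suppose there exist two vertices $v_i$ and $v_j$ with Laplacian degrees satisfying $\delta_i\geq \delta_j+2(k-1)$, and an edge $e\in E(\mathcal{H})$ with $v_i\in e$ and $v_j\notin e$. Let $\mathcal{H}'$ be the hypergraph obtained from $\mathcal{H}$ by moving the edge $e$ from $v_i$ to $v_j$. Then $h(\mathcal{H})>h(\mathcal{H}')$.
   Context: For distinct vertices $v_i,v_j$ of a hypergraph $\mathcal{H}$ on vertex set $\{v_1,\dots,v_n\}$, let $a_{ij}$ be the number of edges containing both $v_i$ and $v_j$ (with $a_{ii}=0$); the Laplacian degree of $v_i$ is $\delta_i=\sum_{j=1}^n a_{ij}$. Define $h(\mathcal{H})=\sum_{i=1}^n\delta_i\log_2\delta_i$, where the Laplacian degrees are computed in $\mathcal{H}$ (and for $h(\mathcal{H}')$, in $\mathcal{H}'$). Moving an edge: if $u\notin e\in E(\mathcal{H})$ and $v\in e$, put $e'=(e\setminus\{v\})\cup\{u\}$; the hypergraph with the same vertex set and edge set $(E(\mathcal{H})\setminus\{e\})\cup\{e'\}$ is said to be obtained from $\mathcal{H}$ by moving the edge $e$ from $v$ to $u$. -}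

module Defs where

open import Data.Nat using (ℕ; zero; suc; _^_; _*_)
open import Data.Bool using (Bool; true; false; if_then_else_)
open import Data.Fin using (Fin; _≟_)
open import Data.Fin.Subset using (Subset; _∈_; _∉_; ∣_∣; inside; outside)
open import Data.Fin.Subset.Properties using (_∈?_)
open import Data.Vec using (_[_]≔_)
open import Data.Nat.ListAction using (sum)
open import Data.List using (List; length; filter; map; allFin; foldr; _++_; [_])
open import Data.List.Relation.Unary.All using (All)
open import Data.List.Relation.Unary.Unique.Propositional using (Unique)
import Data.List.Membership.Propositional as Mem
open import Data.List.Relation.Unary.Any using (_─_)
open import Relation.Nullary.Decidable using (_×-dec_; does)
open import Relation.Binary.PropositionalEquality using (_≡_)

-- A (multi-)hypergraph on vertex set Fin n: a list of edges, each edge a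
-- subset of the vertex set.
Hypergraph : ℕ → Set
Hypergraph n = List (Subset n)

Uniform : ∀ {n} → ℕ → Hypergraph n → Set
Uniform k E = All (λ e → ∣ e ∣ ≡ k) E

Simple : ∀ {n} → Hypergraph n → Set
Simple E = Unique E

data Reach {n} (E : Hypergraph n) : Fin n → Fin n → Set where
  here : ∀ {u} → Reach E u u
  step : ∀ {u w v} (e : Subset n) → e Mem.∈ E → u ∈ e → w ∈ e →
         Reach E w v → Reach E u v

Connected : ∀ {n} → Hypergraph n → Set
Connected {n} E = ∀ (u v : Fin n) → Reach E u v

adj : ∀ {n} → Hypergraph n → Fin n → Fin n → ℕ
adj E i j = if does (i ≟ j) then 0
            else length (filter (λ e → (i ∈? e) ×-dec (j ∈? e)) E)

lapDeg : ∀ {n} → Hypergraph n → Fin n → ℕ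
lapDeg {n} E i = sum (map (adj E i) (allFin n))

-- 2 ^ h(H) = ∏_i δ_i ^ δ_i  (with 0^0 = 1, matching 0 log 0 = 0),
-- since h(H) = Σ_i δ_i log₂ δ_i = log₂ ∏_i δ_i^δ_i.
expH : ∀ {n} → Hypergraph n → ℕ
expH {n} E = foldr _*_ 1 (map (λ i → lapDeg E i ^ lapDeg E i) (allFin n))

moveEdge : ∀ {n} (E : Hypergraph n) {e : Subset n} → e Mem.∈ E →
           (v u : Fin n) → Hypergraph n
moveEdge E {e} e∈E v u = (E ─ e∈E) ++ [ (e [ v ]≔ outside) [ u ]≔ inside ]

-- Moving e from v_i to v_j changes only two Laplacian degrees: an edge x contributes ∣x∣ - 1
-- to the degree of each of its vertices, so δ_i drops by k - 1 and δ_j grows by k - 1.  Since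
-- 2^h(H) = ∏ δ^δ, the claim becomes x^x (b+m)^(b+m) < (x+m)^(x+m) b^b for b < x and m = k - 1,
-- with x = δ_i - m and b = δ_j.  This holds because n ↦ n^n is strictly log-convex, i.e. the
-- ratios (n+1)^(n+1) / n^n increase; log-convexity in turn follows from the bound
-- (a+1)^(n+1) ≤ a^(n+1) + (n+1)(a+1)^n at a = n(n+2), for which a + 1 = (n+1)^2.

module Submission where

open import Defs
open import Data.Nat using (ℕ; _≤_; _<_; _+_; _*_; _∸_)
open import Data.Fin using (Fin)
open import Data.Fin.Subset using (Subset; _∈_; _∉_)
open import Data.List.Membership.Propositional using () renaming (_∈_ to _∈ₗ_)

open import Algebra.Bundles using (CommutativeMonoid)
import Algebra.Properties.CommutativeMonoid.Sum as Sum
open import Data.Bool using (true; false; if_then_else_)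
open import Data.Bool.Properties using (¬-not)
open import Data.Fin using (zero; suc; punchIn; _≟_)
open import Data.Fin.Properties using (punchInᵢ≢i)
open import Data.Fin.Subset using (∣_∣; inside; outside)
open import Data.Fin.Subset.Properties using (_∈?_)
open import Data.List as List using (_∷_; _++_; [_]; allFin)
open import Data.List.Properties using (map-tabulate; filter-++; length-++)
open import Data.List.Relation.Unary.All as All using ()
open import Data.List.Relation.Unary.Any using (here; there; _─_)
open import Data.Nat using (zero; suc; _^_; z≤n; s≤s; _<′_; ≤′-refl; ≤′-step; >-nonZero)
open import Data.Nat.Properties
  using ( ≤-reflexive; ≤-trans; <⇒≤; <-≤-trans; n≤1+n; n<1+n; m<m+n; <⇒<′
        ; +-comm; +-suc; +-identityʳ; *-comm; +-cancelʳ-≡; +-cancelʳ-≤; *-cancelˡ-<; *-cancelʳ-<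
        ; +-monoˡ-≤; +-monoʳ-≤; +-monoˡ-<; *-mono-≤; *-monoˡ-≤; *-monoʳ-≤; *-monoˡ-<; *-monoʳ-<
        ; ^-monoˡ-≤; m^n>0; m^n≢0; m*n≢0; ∸-monoˡ-≤; m+n∸n≡m
        ; +-0-commutativeMonoid; *-1-commutativeMonoid; module ≤-Reasoning )
open import Data.Nat.Tactic.RingSolver using (solve-∀)
open import Data.Vec using (_∷_; []; here; there; lookup; _[_]≔_)
open import Data.Vec.Properties using (lookup∘update; lookup∘update′; []=⇒lookup; lookup⇒[]=)
import Data.Vec.Functional as Vector
open import Data.Vec.Functional.Properties using (updateAt-updates; updateAt-minimal)
open import Function using (id; const; _∘_)
open import Relation.Binary.PropositionalEquality
  using (_≡_; _≢_; refl; sym; trans; cong; cong₂; subst; subst₂; module ≡-Reasoning)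
open import Relation.Nullary.Decidable using (does; yes; no; dec-true; dec-false)

selfPow : ℕ → ℕ
selfPow n = n ^ n

selfPow>0 : ∀ n → 0 < selfPow n
selfPow>0 zero    = s≤s z≤n
selfPow>0 (suc n) = m^n>0 (suc n) (suc n)

-- f (n+1) / f n < f (n+2) / f (n+1), cross-multiplied; all ratio comparisons below are
-- stated in this cross-multiplied form.
StrictlyLogConvex : (ℕ → ℕ) → Set
StrictlyLogConvex f = ∀ n → f (suc n) * f (suc n) < f (2 + n) * f n

^-distribʳ-* : ∀ m n k → (m * n) ^ k ≡ m ^ k * n ^ k
^-distribʳ-* m n zero    = refl
^-distribʳ-* m n (suc k) = begin
  m * n * (m * n) ^ k      ≡⟨ cong (m * n *_) (^-distribʳ-* m n k) ⟩
  m * n * (m ^ k * n ^ k)  ≡⟨ *-interchange m n (m ^ k) (n ^ k) ⟩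
  m * m ^ k * (n * n ^ k)  ∎
  where
  open ≡-Reasoning
  *-interchange : ∀ a b c d → a * b * (c * d) ≡ a * c * (b * d)
  *-interchange = solve-∀

-- The mean value bound for x ↦ x^(m+1) on [a, a+1].
suc-^-suc-≤ : ∀ a m → suc a ^ suc m ≤ a ^ suc m + suc m * suc a ^ m
suc-^-suc-≤ a zero    = ≤-reflexive (+-comm 1 (a * 1))
suc-^-suc-≤ a (suc m) = begin
  suc a * suc a ^ suc m                             ≤⟨ *-monoʳ-≤ (suc a) (suc-^-suc-≤ a m) ⟩
  suc a * (A + suc m * B)                           ≡⟨ expand a A B m ⟩
  a * A + A + suc m * (suc a * B)                   ≤⟨ +-monoˡ-≤ _ (+-monoʳ-≤ (a * A) monotone) ⟩
  a * A + suc a * B + suc m * (suc a * B)           ≡⟨ collect a A B m ⟩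
  a * A + suc (suc m) * (suc a * B)                 ∎
  where
  open ≤-Reasoning
  A = a ^ suc m
  B = suc a ^ m
  monotone : A ≤ suc a * B
  monotone = ^-monoˡ-≤ (suc m) (n≤1+n a)
  expand : ∀ a A B m → suc a * (A + suc m * B) ≡ a * A + A + suc m * (suc a * B)
  expand = solve-∀
  collect : ∀ a A B m → a * A + suc a * B + suc m * (suc a * B) ≡ a * A + suc (suc m) * (suc a * B)
  collect = solve-∀

suc-square-^-≤ : ∀ n → n * suc n * (suc n * suc n) ^ n ≤ (n * (2 + n)) ^ suc n
suc-square-^-≤ n = +-cancelʳ-≤ (u * T) _ _ (begin
  n * u * T + u * T   ≡⟨ distrib n T ⟩
  (u * u) ^ u         ≤⟨ subst (λ x → x ^ u ≤ a ^ u + u * x ^ n) (square n) (suc-^-suc-≤ a n) ⟩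
  a ^ u + u * T       ∎)
  where
  open ≤-Reasoning
  u = suc n
  a = n * (2 + n)
  T = (u * u) ^ n
  distrib : ∀ n T → n * suc n * T + suc n * T ≡ suc n * suc n * T
  distrib = solve-∀
  square : ∀ n → suc (n * (2 + n)) ≡ suc n * suc n
  square = solve-∀

selfPow-logConvex : StrictlyLogConvex selfPow
selfPow-logConvex zero       = s≤s (s≤s z≤n)
selfPow-logConvex n@(suc _) = *-cancelˡ-< n _ _ (begin-strict
  n * (selfPow u * selfPow u)  ≡⟨ cong (n *_) (^-distribʳ-* u u u) ⟨
  n * (u * u * T)              ≡⟨ regroup n u T ⟩
  u * (n * u * T)              ≤⟨ *-monoʳ-≤ u (suc-square-^-≤ n) ⟩
  u * (n * w) ^ u              <⟨ *-monoˡ-< ((n * w) ^ u) {{m^n≢0 (n * w) u {{m*n≢0 n w}}}} (n<1+n u) ⟩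
  w * (n * w) ^ u              ≡⟨ cong (w *_) (^-distribʳ-* n w u) ⟩
  w * (n * n ^ n * w ^ u)      ≡⟨ regroup′ n w (n ^ n) (w ^ u) ⟩
  n * (selfPow w * selfPow n)  ∎)
  where
  open ≤-Reasoning
  u = suc n
  w = suc u
  T = (u * u) ^ n
  regroup : ∀ n u T → n * (u * u * T) ≡ u * (n * u * T)
  regroup = solve-∀
  regroup′ : ∀ n w N W → w * (n * N * W) ≡ n * (w * W * N)
  regroup′ = solve-∀

*-cross-<-trans : ∀ {p q r s t u} → 0 < q → p * s < r * q → r * u < t * s → p * u < t * q
*-cross-<-trans {p} {q} {r} {s} {t} {u} q>0 ps<rq ru<ts = *-cancelˡ-< s _ _ (begin-strict
  s * (p * u)  ≡⟨ rotate s p u ⟩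
  p * s * u    ≤⟨ *-monoˡ-≤ u (<⇒≤ ps<rq) ⟩
  r * q * u    ≡⟨ rotate′ r q u ⟩
  q * (r * u)  <⟨ *-monoʳ-< q {{>-nonZero q>0}} ru<ts ⟩
  q * (t * s)  ≡⟨ rotate″ q t s ⟩
  s * (t * q)  ∎)
  where
  open ≤-Reasoning
  rotate : ∀ s p u → s * (p * u) ≡ p * s * u
  rotate = solve-∀
  rotate′ : ∀ r q u → r * q * u ≡ q * (r * u)
  rotate′ = solve-∀
  rotate″ : ∀ q t s → q * (t * s) ≡ s * (t * q)
  rotate″ = solve-∀

ratios-increasing : ∀ (p q : ℕ → ℕ) → (∀ n → 0 < q n) →
                    (∀ n → p n * q (suc n) < p (suc n) * q n) →
                    ∀ {m n} → m < n → p m * q n < p n * q m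
ratios-increasing p q q>0 increases m<n = go (<⇒<′ m<n)
  where
  go : ∀ {m n} → m <′ n → p m * q n < p n * q m
  go {m} ≤′-refl          = increases m
  go {m} (≤′-step {n} m<n) =
    *-cross-<-trans {p m} {r = p n} {t = p (suc n)} {q (suc n)} (q>0 m) (go m<n) (increases n)

module _ {f : ℕ → ℕ} (f>0 : ∀ n → 0 < f n) (convex : StrictlyLogConvex f) where

  logConvex⇒successor-ratios-increasing : ∀ {y x} → y < x → f (suc y) * f x < f (suc x) * f y
  logConvex⇒successor-ratios-increasing = ratios-increasing (f ∘ suc) f f>0 convex

  logConvex⇒shift-ratios-increasing : ∀ {b x m} → b < x → 0 < m → f x * f (b + m) < f (x + m) * f b
  logConvex⇒shift-ratios-increasing {b} {x} {m} b<x m>0 =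
    subst₂ _<_ (cong (_* f (b + m)) (cong f (+-identityʳ x))) (cong (f (x + m) *_) (cong f (+-identityʳ b)))
      (ratios-increasing (λ t → f (x + t)) (λ t → f (b + t)) (λ t → f>0 (b + t)) consecutive m>0)
    where
    consecutive : ∀ t → f (x + t) * f (b + suc t) < f (x + suc t) * f (b + t)
    consecutive t rewrite +-suc b t | +-suc x t =
      subst (_< f (suc (x + t)) * f (b + t)) (*-comm (f (suc (b + t))) (f (x + t)))
        (logConvex⇒successor-ratios-increasing (+-monoˡ-< t b<x))

m+2*n≤o+n⇒m<o : ∀ {m n o} → 0 < n → m + 2 * n ≤ o + n → m < o
m+2*n≤o+n⇒m<o {m} {n} {o} n>0 m+2n≤o+n = <-≤-trans (m<m+n m n>0) (+-cancelʳ-≤ n (m + n) o (begin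
  m + n + n  ≡⟨ regroup m n ⟩
  m + 2 * n  ≤⟨ m+2n≤o+n ⟩
  o + n      ∎))
  where
  open ≤-Reasoning
  regroup : ∀ m n → m + n + n ≡ m + 2 * n
  regroup = solve-∀

module _ {c ℓ} (M : CommutativeMonoid c ℓ) where

  open CommutativeMonoid M
    using (Carrier; _≈_; _∙_; ∙-congˡ; ∙-congʳ; assoc; comm; setoid; commutativeSemigroup)
  open Sum M using (sum; sum-remove; sum-cong-≋)
  open import Algebra.Properties.CommutativeSemigroup commutativeSemigroup
    using (xy∙z≈zy∙x; xy∙z≈xz∙y)
  open import Relation.Binary.Reasoning.Setoid setoid

  sum-differ-at : ∀ {n} {f g : Vector.Vector Carrier n} v → (∀ w → w ≢ v → f w ≈ g w) →
                  sum f ∙ g v ≈ sum g ∙ f v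
  sum-differ-at {suc n} {f} {g} v f≈g = begin
    sum f ∙ g v                      ≈⟨ ∙-congʳ (sum-remove f) ⟩
    f v ∙ sum (f ∘ punchIn v) ∙ g v  ≈⟨ ∙-congʳ (∙-congˡ (sum-cong-≋ λ w → f≈g _ (punchInᵢ≢i v w))) ⟩
    f v ∙ sum (g ∘ punchIn v) ∙ g v  ≈⟨ xy∙z≈zy∙x _ _ _ ⟩
    g v ∙ sum (g ∘ punchIn v) ∙ f v  ≈⟨ ∙-congʳ (sum-remove g) ⟨
    sum g ∙ f v                      ∎

  sum-differ-at₂ : ∀ {n} {f g : Vector.Vector Carrier n} {i j} → i ≢ j →
                   (∀ w → w ≢ i → w ≢ j → f w ≈ g w) →
                   sum f ∙ (g i ∙ g j) ≈ sum g ∙ (f i ∙ f j)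
  sum-differ-at₂ {f = f} {g} {i} {j} i≢j f≈g = begin
    sum f ∙ (g i ∙ g j)  ≈⟨ assoc _ _ _ ⟨
    sum f ∙ g i ∙ g j    ≡⟨ cong (λ x → sum f ∙ x ∙ g j) (updateAt-updates i f) ⟨
    sum f ∙ h i ∙ g j    ≈⟨ ∙-congʳ (sum-differ-at i f≈h) ⟩
    sum h ∙ f i ∙ g j    ≈⟨ xy∙z≈xz∙y _ _ _ ⟩
    sum h ∙ g j ∙ f i    ≈⟨ ∙-congʳ (sum-differ-at j h≈g) ⟩
    sum g ∙ h j ∙ f i    ≡⟨ cong (λ x → sum g ∙ x ∙ f i) (updateAt-minimal j i f (i≢j ∘ sym)) ⟩
    sum g ∙ f j ∙ f i    ≈⟨ assoc _ _ _ ⟩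
    sum g ∙ (f j ∙ f i)  ≈⟨ ∙-congˡ (comm _ _) ⟩
    sum g ∙ (f i ∙ f j)  ∎
    where
    h : Vector.Vector Carrier _
    h = Vector.updateAt f i (const (g i))
    f≈h : ∀ w → w ≢ i → f w ≈ h w
    f≈h w w≢i = begin
      f w  ≡⟨ updateAt-minimal w i f w≢i ⟨
      h w  ∎
    h≈g : ∀ w → w ≢ j → h w ≈ g w
    h≈g w w≢j with w ≟ i
    ... | yes refl = begin
      h i  ≡⟨ updateAt-updates i f ⟩
      g i  ∎
    ... | no w≢i   = begin
      h w  ≡⟨ updateAt-minimal w i f w≢i ⟩
      f w  ≈⟨ f≈g w w≢i w≢j ⟩
      g w  ∎

open Sum +-0-commutativeMonoid using (∑-distrib-+; sum-cong-≗; sum-replicate-zero) renaming (sum to ∑)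
open Sum *-1-commutativeMonoid using () renaming (sum to ∏)

foldr-map-allFin : ∀ {A B : Set} (_∙_ : A → B → B) (ε : B) {n} (f : Fin n → A) →
                   List.foldr _∙_ ε (List.map f (allFin n)) ≡ Vector.foldr _∙_ ε f
foldr-map-allFin _∙_ ε f = trans (cong (List.foldr _∙_ ε) (map-tabulate id f)) (foldr-tabulate f)
  where
  foldr-tabulate : ∀ {n} (f : Fin n → _) → List.foldr _∙_ ε (List.tabulate f) ≡ Vector.foldr _∙_ ε f
  foldr-tabulate {zero}  f = refl
  foldr-tabulate {suc n} f = cong (f zero ∙_) (foldr-tabulate (f ∘ suc))

lapDeg≡∑adj : ∀ {n} (E : Hypergraph n) v → lapDeg E v ≡ ∑ (adj E v)
lapDeg≡∑adj E v = foldr-map-allFin _+_ 0 (adj E v)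

expH≡∏ : ∀ {n} (E : Hypergraph n) → expH E ≡ ∏ (selfPow ∘ lapDeg E)
expH≡∏ E = foldr-map-allFin _*_ 1 (selfPow ∘ lapDeg E)

∏-pos : ∀ {n} (f : Fin n → ℕ) → (∀ v → 0 < f v) → 0 < ∏ f
∏-pos {zero}  f f>0 = s≤s z≤n
∏-pos {suc n} f f>0 = *-mono-≤ (f>0 zero) (∏-pos (f ∘ suc) (f>0 ∘ suc))

∏-decreases : ∀ {n} {f g : Fin n → ℕ} {i j} → (∀ v → 0 < f v) → i ≢ j →
              (∀ v → v ≢ i → v ≢ j → f v ≡ g v) → g i * g j < f i * f j → ∏ g < ∏ f
∏-decreases {f = f} {g} {i} {j} f>0 i≢j f≡g gi*gj<fi*fj = *-cancelʳ-< (f i * f j) _ _ (begin-strict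
  ∏ g * (f i * f j)  ≡⟨ sum-differ-at₂ *-1-commutativeMonoid i≢j f≡g ⟨
  ∏ f * (g i * g j)  <⟨ *-monoʳ-< (∏ f) {{>-nonZero (∏-pos f f>0)}} gi*gj<fi*fj ⟩
  ∏ f * (f i * f j)  ∎)
  where open ≤-Reasoning

χ : ∀ {n} → Subset n → Fin n → ℕ
χ p w = if does (w ∈? p) then 1 else 0

∣p∣≡∑χ : ∀ {n} (p : Subset n) → ∣ p ∣ ≡ ∑ (χ p)
∣p∣≡∑χ []            = refl
∣p∣≡∑χ (outside ∷ p) = ∣p∣≡∑χ p
∣p∣≡∑χ (inside ∷ p)  = cong suc (∣p∣≡∑χ p)

adj-++ : ∀ {n} (L M : Hypergraph n) v w → adj (L ++ M) v w ≡ adj L v w + adj M v w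
adj-++ L M v w with does (v ≟ w)
... | true  = refl
... | false = trans (cong List.length (filter-++ _ L M)) (length-++ (List.filter _ L))

lapDeg-++ : ∀ {n} (L M : Hypergraph n) v → lapDeg (L ++ M) v ≡ lapDeg L v + lapDeg M v
lapDeg-++ L M v = begin
  lapDeg (L ++ M) v                     ≡⟨ lapDeg≡∑adj (L ++ M) v ⟩
  ∑ (adj (L ++ M) v)                    ≡⟨ sum-cong-≗ (adj-++ L M v) ⟩
  ∑ (λ w → adj L v w + adj M v w)       ≡⟨ ∑-distrib-+ (adj L v) (adj M v) ⟩
  ∑ (adj L v) + ∑ (adj M v)             ≡⟨ cong₂ _+_ (lapDeg≡∑adj L v) (lapDeg≡∑adj M v) ⟨
  lapDeg L v + lapDeg M v               ∎
  where open ≡-Reasoning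

lapDeg-─ : ∀ {n} {E : Hypergraph n} {e} (e∈E : e ∈ₗ E) v →
           lapDeg E v ≡ lapDeg [ e ] v + lapDeg (E ─ e∈E) v
lapDeg-─ {E = e ∷ L} (here refl) v = lapDeg-++ [ e ] L v
lapDeg-─ {E = x ∷ L} {e} (there e∈L) v = begin
  lapDeg (x ∷ L) v                  ≡⟨ lapDeg-++ [ x ] L v ⟩
  dx + lapDeg L v                   ≡⟨ cong (dx +_) (lapDeg-─ e∈L v) ⟩
  dx + (de + rest)                  ≡⟨ swap dx de rest ⟩
  de + (dx + rest)                  ≡⟨ cong (de +_) (lapDeg-++ [ x ] (L ─ e∈L) v) ⟨
  de + lapDeg (x ∷ (L ─ e∈L)) v     ∎
  where
  open ≡-Reasoning
  dx = lapDeg [ x ] v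
  de = lapDeg [ e ] v
  rest = lapDeg (L ─ e∈L) v
  swap : ∀ a b c → a + (b + c) ≡ b + (a + c)
  swap = solve-∀

adj-[]-∉ : ∀ {n} {x : Subset n} {v} → v ∉ x → ∀ w → adj [ x ] v w ≡ 0
adj-[]-∉ {x = x} {v} v∉x w with does (v ≟ w)
... | true  = refl
... | false rewrite dec-false (v ∈? x) v∉x = refl

adj-[]-∈ : ∀ {n} {x : Subset n} {v} → v ∈ x → ∀ w → w ≢ v → adj [ x ] v w ≡ χ x w
adj-[]-∈ {x = x} {v} v∈x w w≢v
  rewrite dec-false (v ≟ w) (w≢v ∘ sym) | dec-true (v ∈? x) v∈x with does (w ∈? x)
... | true  = refl
... | false = refl

adj-diagonal : ∀ {n} (E : Hypergraph n) v → adj E v v ≡ 0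
adj-diagonal E v rewrite dec-true (v ≟ v) refl = refl

lapDeg-singleton : ∀ {n} (x : Subset n) v → lapDeg [ x ] v ≡ (if lookup x v then ∣ x ∣ ∸ 1 else 0)
lapDeg-singleton {n} x v with lookup x v in v∈?x
... | true  = trans (sym (m+n∸n≡m _ 1)) (cong (_∸ 1) (counted (lookup⇒[]= v x v∈?x)))
  where
  counted : v ∈ x → lapDeg [ x ] v + 1 ≡ ∣ x ∣
  counted v∈x = begin
    lapDeg [ x ] v + 1       ≡⟨ cong₂ _+_ (lapDeg≡∑adj [ x ] v) (sym χxv) ⟩
    ∑ (adj [ x ] v) + χ x v  ≡⟨ sum-differ-at +-0-commutativeMonoid v (adj-[]-∈ v∈x) ⟩
    ∑ (χ x) + adj [ x ] v v  ≡⟨ cong (∑ (χ x) +_) (adj-diagonal [ x ] v) ⟩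
    ∑ (χ x) + 0              ≡⟨ +-identityʳ _ ⟩
    ∑ (χ x)                  ≡⟨ ∣p∣≡∑χ x ⟨
    ∣ x ∣                    ∎
    where
    open ≡-Reasoning
    χxv : χ x v ≡ 1
    χxv rewrite dec-true (v ∈? x) v∈x = refl
... | false = begin
  lapDeg [ x ] v      ≡⟨ lapDeg≡∑adj [ x ] v ⟩
  ∑ (adj [ x ] v)     ≡⟨ sum-cong-≗ (adj-[]-∉ v∉x) ⟩
  ∑ {n} (λ _ → 0)     ≡⟨ sum-replicate-zero n ⟩
  0                   ∎
  where
  open ≡-Reasoning
  v∉x : v ∉ x
  v∉x v∈x with () ← trans (sym v∈?x) ([]=⇒lookup v∈x)

replaceVertex : ∀ {n} → Subset n → Fin n → Fin n → Subset n
replaceVertex e v u = (e [ v ]≔ outside) [ u ]≔ inside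

∣p[x]≔inside∣ : ∀ {n} {p : Subset n} {x} → x ∉ p → ∣ p [ x ]≔ inside ∣ ≡ suc ∣ p ∣
∣p[x]≔inside∣ {p = outside ∷ p} {zero}  x∉p = refl
∣p[x]≔inside∣ {p = inside ∷ p}  {zero}  x∉p with () ← x∉p here
∣p[x]≔inside∣ {p = outside ∷ p} {suc x} x∉p = ∣p[x]≔inside∣ (x∉p ∘ there)
∣p[x]≔inside∣ {p = inside ∷ p}  {suc x} x∉p = cong suc (∣p[x]≔inside∣ (x∉p ∘ there))

∣p[x]≔outside∣ : ∀ {n} {p : Subset n} {x} → x ∈ p → suc ∣ p [ x ]≔ outside ∣ ≡ ∣ p ∣
∣p[x]≔outside∣ {p = inside ∷ p}  {zero}  here        = refl
∣p[x]≔outside∣ {p = outside ∷ p} {suc x} (there x∈p) = ∣p[x]≔outside∣ x∈p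
∣p[x]≔outside∣ {p = inside ∷ p}  {suc x} (there x∈p) = cong suc (∣p[x]≔outside∣ x∈p)

lapDeg-moveEdge : ∀ {n} {E : Hypergraph n} {e} (e∈E : e ∈ₗ E) i j v →
                  lapDeg (moveEdge E e∈E i j) v + lapDeg [ e ] v ≡
                  lapDeg E v + lapDeg [ replaceVertex e i j ] v
lapDeg-moveEdge {E = E} {e} e∈E i j v = begin
  lapDeg ((E ─ e∈E) ++ [ e′ ]) v + de  ≡⟨ cong (_+ de) (lapDeg-++ (E ─ e∈E) [ e′ ] v) ⟩
  rest + de′ + de                      ≡⟨ rearrange rest de′ de ⟩
  de + rest + de′                      ≡⟨ cong (_+ de′) (lapDeg-─ e∈E v) ⟨
  lapDeg E v + de′                     ∎
  where
  open ≡-Reasoning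
  e′ = replaceVertex e i j
  de = lapDeg [ e ] v
  de′ = lapDeg [ e′ ] v
  rest = lapDeg (E ─ e∈E) v
  rearrange : ∀ a b c → a + b + c ≡ c + a + b
  rearrange = solve-∀

module _ {n} {E : Hypergraph n} {e} (e∈E : e ∈ₗ E) {i j} (i∈e : i ∈ e) (j∉e : j ∉ e) where

  private
    e′ = replaceVertex e i j
    i≢j : i ≢ j
    i≢j refl = j∉e i∈e

    e′-i : lookup e′ i ≡ false
    e′-i = trans (lookup∘update′ i≢j (e [ i ]≔ outside) inside) (lookup∘update i e outside)

    e′-j : lookup e′ j ≡ true
    e′-j = lookup∘update j (e [ i ]≔ outside) inside

    e′-other : ∀ {v} → v ≢ i → v ≢ j → lookup e′ v ≡ lookup e v
    e′-other v≢i v≢j =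
      trans (lookup∘update′ v≢j (e [ i ]≔ outside) inside) (lookup∘update′ v≢i e outside)

    ∣e′∣ : ∣ e′ ∣ ≡ ∣ e ∣
    ∣e′∣ = trans (∣p[x]≔inside∣ j∉e[i]≔outside) (∣p[x]≔outside∣ i∈e)
      where
      j∉e[i]≔outside : j ∉ e [ i ]≔ outside
      j∉e[i]≔outside j∈ =
        j∉e (lookup⇒[]= j e (trans (sym (lookup∘update′ (i≢j ∘ sym) e outside)) ([]=⇒lookup j∈)))

    e-j : lookup e j ≡ false
    e-j = ¬-not (j∉e ∘ lookup⇒[]= j e)

  lapDeg-moveEdge-source : lapDeg (moveEdge E e∈E i j) i + (∣ e ∣ ∸ 1) ≡ lapDeg E i
  lapDeg-moveEdge-source
    with eq ← lapDeg-moveEdge e∈E i j i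
    rewrite lapDeg-singleton e i | lapDeg-singleton e′ i | []=⇒lookup i∈e | e′-i
    = trans eq (+-identityʳ _)

  lapDeg-moveEdge-target : lapDeg (moveEdge E e∈E i j) j ≡ lapDeg E j + (∣ e ∣ ∸ 1)
  lapDeg-moveEdge-target
    with eq ← lapDeg-moveEdge e∈E i j j
    rewrite lapDeg-singleton e j | lapDeg-singleton e′ j | e-j | e′-j | ∣e′∣
    = trans (sym (+-identityʳ _)) eq

  lapDeg-moveEdge-other : ∀ v → v ≢ i → v ≢ j → lapDeg (moveEdge E e∈E i j) v ≡ lapDeg E v
  lapDeg-moveEdge-other v v≢i v≢j
    with eq ← lapDeg-moveEdge e∈E i j v
    rewrite lapDeg-singleton e v | lapDeg-singleton e′ v | e′-other v≢i v≢j | ∣e′∣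
    = +-cancelʳ-≡ _ _ _ eq

lemma2p3 : ∀ (n k : ℕ) → 3 ≤ k → (E : Hypergraph n) →
    Simple E → Connected E → Uniform k E →
    (i j : Fin n) → lapDeg E j + 2 * (k ∸ 1) ≤ lapDeg E i →
    (e : Subset n) (e∈E : e ∈ₗ E) → i ∈ e → j ∉ e →
    expH (moveEdge E e∈E i j) < expH E
lemma2p3 n k 3≤k E _ _ uniform i j gap e e∈E i∈e j∉e =
  subst₂ _<_ (sym (expH≡∏ E′)) (sym (expH≡∏ E))
    (∏-decreases (selfPow>0 ∘ δ) i≢j unchanged
      (subst₂ _<_ (cong (λ d → selfPow (δ′ i) * selfPow d) (sym target))
                  (cong (λ d → selfPow d * selfPow (δ j)) source)
        (logConvex⇒shift-ratios-increasing selfPow>0 selfPow-logConvex δj<δ′i m>0)))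
  where
  E′ = moveEdge E e∈E i j
  δ = lapDeg E
  δ′ = lapDeg E′
  m = k ∸ 1
  i≢j : i ≢ j
  i≢j refl = j∉e i∈e
  ∣e∣∸1≡m : ∣ e ∣ ∸ 1 ≡ m
  ∣e∣∸1≡m = cong (_∸ 1) (All.lookup uniform e∈E)
  source : δ′ i + m ≡ δ i
  source = subst (λ d → δ′ i + d ≡ δ i) ∣e∣∸1≡m (lapDeg-moveEdge-source e∈E i∈e j∉e)
  target : δ′ j ≡ δ j + m
  target = subst (λ d → δ′ j ≡ δ j + d) ∣e∣∸1≡m (lapDeg-moveEdge-target e∈E i∈e j∉e)
  unchanged : ∀ v → v ≢ i → v ≢ j → selfPow (δ v) ≡ selfPow (δ′ v)
  unchanged v v≢i v≢j = cong selfPow (sym (lapDeg-moveEdge-other e∈E i∈e j∉e v v≢i v≢j))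
  m>0 : 0 < m
  m>0 = ≤-trans (s≤s z≤n) (∸-monoˡ-≤ 1 3≤k)
  δj<δ′i : δ j < δ′ i
  δj<δ′i = m+2*n≤o+n⇒m<o m>0 (subst (δ j + 2 * m ≤_) (sym source) gap)
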